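{- Let $X$ be a nonempty set and $R\subseteq X\times X$. Let $\langle R\rangle:2^X\to 2^X$ be $\langle R\rangle(Y)=\{x: R(x)\cap Y\neq\emptyset\}$, where $R(x)=\{y: xRy\}$, and let $-R=(X\times X)\setminus R$. Then the dual pseudocomplement of $\langle R\rangle$ in the join semilattice $M(2^X)$ of modal operators on the power set algebra $2^X$ is $\langle -R\rangle$, i.e. $\langle R\rangle^\bot=\langle -R\rangle$.
   Context: A modal operator on a Boolean algebra $B$ is a map $f$ with $f(0)=0$ and $f(x+y)=f(x)+f(y)$; $M(B)$ is the set of these, ordered pointwise with join $(f\lor g)(x)=f(x)+g(x)$ and top the unary discriminator $f^{\mathbf 1}$ ($f^{\mathbf 1}(0)=0$, $f^{\mathbf 1}(x)=1$ otherwise). The dual pseudocomplement $f^\bot$ is the least $g\in M(B)$ with $f\lor g=f^{\mathbf 1}$. -}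

module Defs where

open import Data.Product using (Σ; ∃; _×_; _,_)
open import Data.Sum using (_⊎_)
open import Data.Empty using (⊥)
open import Data.Unit using (⊤)
open import Relation.Nullary using (¬_)

Subset : Set → Set₁
Subset X = X → Set

module _ {X : Set} where

  ∅ : Subset X
  ∅ _ = ⊥

  _∪_ : Subset X → Subset X → Subset X
  (A ∪ B) x = A x ⊎ B x

  _⊆_ : Subset X → Subset X → Set
  A ⊆ B = ∀ x → A x → B x

  _≐_ : Subset X → Subset X → Set
  A ≐ B = (A ⊆ B) × (B ⊆ A)

  Op : Set₁
  Op = Subset X → Subset X

  record IsModal (f : Op) : Set₁ where
    field
      cong-≐   : ∀ A B → A ≐ B → f A ≐ f B
      pres-∅   : f ∅ ≐ ∅
      pres-∪   : ∀ A B → f (A ∪ B) ≐ (f A ∪ f B)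

  _≤M_ : Op → Op → Set₁
  f ≤M g = ∀ A → f A ⊆ g A

  _≈M_ : Op → Op → Set₁
  f ≈M g = ∀ A → f A ≐ g A

  _∨M_ : Op → Op → Op
  (f ∨M g) A = f A ∪ g A

  -- unary discriminator: f¹(∅) = ∅, f¹(A) = X for A ≠ ∅
  -- (x ∈ f¹(A) iff A is inhabited)
  f¹ : Op
  f¹ A x = ∃ λ y → A y

  IsDualPseudocomplement : Op → Op → Set₁
  IsDualPseudocomplement f g =
    IsModal g × ((f ∨M g) ≈M f¹) ×
    (∀ h → IsModal h → (f ∨M h) ≈M f¹ → g ≤M h)

  ⟨_⟩ : (X → X → Set) → Op
  ⟨ R ⟩ Y x = ∃ λ y → R x y × Y y

  -ʳ_ : (X → X → Set) → (X → X → Set)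
  (-ʳ R) x y = ¬ R x y

module Submission where

open import Defs
open import Axiom.ExcludedMiddle using (ExcludedMiddle)
open import Level using (0ℓ)
open import Data.Product using (_,_; proj₁; proj₂)
open import Data.Sum using (_⊎_; inj₁; inj₂)
open import Data.Empty using (⊥-elim)
open import Relation.Nullary using (yes; no)
open import Relation.Binary.PropositionalEquality using (_≡_; refl)

-- Since ⟨R⟩ and ⟨-R⟩ split every pair (x,y) between them, their join is
-- the discriminator. Conversely, if ⟨R⟩ ∨ h = f¹ and ¬ x R y, then x ∈ f¹{y}
-- but x ∉ ⟨R⟩{y}, so x ∈ h{y}; monotonicity of h then gives ⟨-R⟩ ≤ h.

module _ {X : Set} where

  ｛_｝ : X → Subset X
  ｛ y ｝ z = z ≡ y

  ∪-absorbˡ : {A B : Subset X} → A ⊆ B → (A ∪ B) ≐ B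
  ∪-absorbˡ A⊆B = (λ { x (inj₁ a) → A⊆B x a ; x (inj₂ b) → b }) , (λ x → inj₂)

  ｛｝-∪-absorb : {A : Subset X} {y : X} → A y → (｛ y ｝ ∪ A) ≐ A
  ｛｝-∪-absorb a = ∪-absorbˡ λ { _ refl → a }

  IsModal⇒mono : {f : Op} → IsModal f → {A B : Subset X} → A ⊆ B → f A ⊆ f B
  IsModal⇒mono {f} fm {A} {B} A⊆B x fAx =
    proj₁ (cong-≐ (A ∪ B) B (∪-absorbˡ A⊆B)) x (proj₂ (pres-∪ A B) x (inj₁ fAx))
    where open IsModal fm

  ⟨⟩-isModal : (R : X → X → Set) → IsModal ⟨ R ⟩
  ⟨⟩-isModal R = record
    { cong-≐ = λ A B A≐B → mono (proj₁ A≐B) , mono (proj₂ A≐B)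
    ; pres-∅ = (λ { x (_ , _ , ()) }) , (λ x ())
    ; pres-∪ = λ A B →
        (λ { x (y , r , inj₁ a) → inj₁ (y , r , a)
           ; x (y , r , inj₂ b) → inj₂ (y , r , b) })
      , (λ { x (inj₁ (y , r , a)) → y , r , inj₁ a
           ; x (inj₂ (y , r , b)) → y , r , inj₂ b })
    }
    where
    mono : {A B : Subset X} → A ⊆ B → ⟨ R ⟩ A ⊆ ⟨ R ⟩ B
    mono A⊆B x (y , r , a) = y , r , A⊆B y a

  ⟨⟩≤f¹ : (R : X → X → Set) → ⟨ R ⟩ ≤M f¹
  ⟨⟩≤f¹ R A x (y , _ , a) = y , a

  ⟨⟩-∨-cover≈f¹ : (R S : X → X → Set) → (∀ x y → R x y ⊎ S x y) →
                  (⟨ R ⟩ ∨M ⟨ S ⟩) ≈M f¹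
  ⟨⟩-∨-cover≈f¹ R S cover A =
      (λ { x (inj₁ p) → ⟨⟩≤f¹ R A x p ; x (inj₂ q) → ⟨⟩≤f¹ S A x q })
    , (λ x → λ { (y , a) → split x y a (cover x y) })
    where
    split : ∀ x y → A y → R x y ⊎ S x y → (⟨ R ⟩ ∨M ⟨ S ⟩) A x
    split x y a (inj₁ r) = inj₁ (y , r , a)
    split x y a (inj₂ s) = inj₂ (y , s , a)

  ⟨⟩-least : (S : X → X → Set) {h : Op} → IsModal h →
             (∀ x y → S x y → h ｛ y ｝ x) → ⟨ S ⟩ ≤M h
  ⟨⟩-least S hm S⇒h A x (y , s , a) =
    proj₁ (IsModal.cong-≐ hm (｛ y ｝ ∪ A) A (｛｝-∪-absorb a)) x
      (IsModal⇒mono hm (λ z → inj₁) x (S⇒h x y s))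

  ∨≈f¹⇒-ʳ⊆h｛｝ : (R : X → X → Set) (h : Op) → (⟨ R ⟩ ∨M h) ≈M f¹ →
                       ∀ x y → (-ʳ R) x y → h ｛ y ｝ x
  ∨≈f¹⇒-ʳ⊆h｛｝ R h join≈f¹ x y ¬r
    with proj₂ (join≈f¹ ｛ y ｝) x (y , refl)
  ... | inj₁ (_ , r , refl) = ⊥-elim (¬r r)
  ... | inj₂ hyx = hyx

mainTheorem6 : ExcludedMiddle 0ℓ → (X : Set) → X → (R : X → X → Set) →
    IsDualPseudocomplement ⟨ R ⟩ ⟨ -ʳ R ⟩
mainTheorem6 em X _ R =
    ⟨⟩-isModal (-ʳ R)
  , ⟨⟩-∨-cover≈f¹ R (-ʳ R) decide
  , λ h hm join≈f¹ → ⟨⟩-least (-ʳ R) hm (∨≈f¹⇒-ʳ⊆h｛｝ R h join≈f¹)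
  where
  decide : ∀ x y → R x y ⊎ (-ʳ R) x y
  decide x y with em {R x y}
  ... | yes r = inj₁ r
  ... | no ¬r = inj₂ ¬r
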